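{- Let $n,b,k>0$ be integers with $2\le b\le (n+1)^{1/k}$, and let $X=\{0,1,\dots,n\}$. Then there exist $k$ permutations $\phi_1,\dots,\phi_k:X\to X$ such that for any distinct $x,y\in X$ there exists some $i$ with $$|\phi_i(x)-\phi_i(y)|>b^{k-1}-2b^{k-3}.$$ -}

module Defs where

open import Data.Nat using (ℕ; suc; _^_; _*_; _∸_; ∣_-_∣)
open import Data.Integer as ℤ using (ℤ; +_)
open import Data.Fin using (Fin; toℕ)

-- "d > b^(k-1) - 2 b^(k-3)" for a natural distance d, stated exactly (the
-- threshold may be a non-integer rational when k < 3) by multiplying both
-- sides by b^2 > 0:   b^2 * d  >  b^(k+1) - 2 * b^(k-1)   (in ℤ).
-- Only used with k ≥ 1, where k+1 and k-1 are honest natural exponents.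
ExceedsThreshold : (b k : ℕ) → ℕ → Set
ExceedsThreshold b k d =
  (+ (b ^ (suc k))) ℤ.- (+ (2 * b ^ (k ∸ 1))) ℤ.< + (b ^ 2 * d)

dist : {m : ℕ} → Fin m → Fin m → ℕ
dist a c = ∣ toℕ a - toℕ c ∣

module Submission where

-- Write x = col x + row x * b (column x % b, row x / b), so X consists of
-- M = N / b full rows of length b followed by a partial row of length r = N % b.
-- Two kinds of permutations of X are used (module `Grid.Level`):
--   * `transpose` lists the columns one after the other, each one bottom-up;
--     it moves cells of different columns about M apart;
--   * `lift g` applies a permutation g of the M full rows, keeping columns;
--     it multiplies row distances by b.
-- The family of k + 1 maps on N points is `transpose` together with the lifts
-- of the family of k maps on M points; the one-map family is the identity.
-- The inductive step (`Grid.Step`) turns separation s and "headroom" s (every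
-- point lies s below N in some map, which accounts for the partial row) on M
-- points into separation and headroom s′ on N points, when s′ + L ≤ b s for a
-- column tolerance L.  With the base case of two maps (`FirstLevel`) this gives
-- separation ⌊b^(k-1) − 2b^(k-3)⌋ + 1 (`Construction.required`).

open import Defs
open import Data.Nat
open import Data.Nat.Properties
open import Data.Nat.DivMod
open import Data.Nat.Divisibility using (n∣m*n)
open import Data.Nat.Tactic.RingSolver using (solve-∀)
open import Data.Integer as ℤ using (+_; _⊖_)
import Data.Integer.Properties as ℤP
open import Data.Fin using (Fin; zero; suc; toℕ; fromℕ<; punchOut)
import Data.Fin.Properties as FinP
open import Data.Fin.Permutation using (Permutation′; _⟨$⟩ʳ_; permutation)
open import Data.Product using (Σ; ∃-syntax; _,_; proj₁; proj₂; _×_; map₂)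
open import Data.Sum using (_⊎_; inj₁; inj₂; swap)
open import Data.Empty using (⊥-elim)
open import Function using (id; _∘_)
open import Relation.Binary.PropositionalEquality
open import Relation.Binary.Definitions using (tri<; tri≈; tri>)
open import Relation.Nullary using (¬_; Dec; yes; no)

Apart : ℕ → ℕ → ℕ → Set
Apart s u v = u + s ≤ v ⊎ v + s ≤ u

apart⇒dist : ∀ {s u v} → Apart s u v → s ≤ ∣ u - v ∣
apart⇒dist {s} {u} {v} (inj₁ u+s≤v) rewrite m≤n⇒∣m-n∣≡n∸m (m+n≤o⇒m≤o u u+s≤v) =
  m+n≤o⇒m≤o∸n s (subst (_≤ v) (+-comm u s) u+s≤v)
apart⇒dist {s} {u} {v} (inj₂ v+s≤u) rewrite ∣-∣-comm u v = apart⇒dist (inj₁ v+s≤u)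

distinct⇒apart : ∀ {x y} → x ≢ y → Apart 1 x y
distinct⇒apart {x} {y} x≢y with <-cmp x y
... | tri< x<y _ _ = inj₁ (subst (_≤ y) (+-comm 1 x) x<y)
... | tri≈ _ x≡y _ = ⊥-elim (x≢y x≡y)
... | tri> _ _ y<x = inj₂ (subst (_≤ x) (+-comm 1 y) y<x)

ℕ-gap⇒ℤ : ∀ {A B C} → A < B + C → + A ℤ.- + B ℤ.< + C
ℕ-gap⇒ℤ {A} {B} {C} A<B+C = begin-strict
  + A ℤ.- + B    ≡⟨ ℤP.m-n≡m⊖n A B ⟩
  A ⊖ B          <⟨ ℤP.⊖-monoˡ-< B A<B+C ⟩
  (B + C) ⊖ B    ≡⟨ ℤP.≤-⊖ (m≤m+n B C) ⟩
  + (B + C ∸ B)  ≡⟨ cong +_ (m+n∸m≡n B C) ⟩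
  + C            ∎
  where open ℤP.≤-Reasoning

injective⇒surjective : ∀ {m} (F : Fin m → Fin m) → (∀ {x y} → F x ≡ F y → x ≡ y) →
                       ∀ y → ∃[ x ] F x ≡ y
injective⇒surjective {suc n} F F-inj y with FinP.any? (λ x → F x FinP.≟ y)
... | yes hit = hit
... | no miss =
  let (i , j , i<j , collide) = FinP.pigeonhole (n<1+n n) avoid
  in ⊥-elim (FinP.<⇒≢ i<j (F-inj (FinP.punchOut-injective {i = y} _ _ collide)))
  where
    avoid : Fin (suc n) → Fin n
    avoid x = punchOut {i = y} {j = F x} (λ y≡Fx → miss (x , sym y≡Fx))

record PermOn (N : ℕ) (f : ℕ → ℕ) : Set where
  field
    bound     : ∀ {x} → x < N → f x < N
    injective : ∀ {x y} → x < N → y < N → f x ≡ f y → x ≡ y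

toPermutation : ∀ {N f} → PermOn N f →
                Σ (Permutation′ N) λ π → ∀ x → toℕ (π ⟨$⟩ʳ x) ≡ f (toℕ x)
toPermutation {N} {f} P =
  permutation F F⁻¹ (λ y → proj₂ (onto y)) (λ x → F-injective (proj₂ (onto (F x)))) ,
  λ x → FinP.toℕ-fromℕ< _
  where
    open PermOn P
    F : Fin N → Fin N
    F x = fromℕ< (bound (FinP.toℕ<n x))
    F-injective : ∀ {x y} → F x ≡ F y → x ≡ y
    F-injective {x} {y} Fx≡Fy = FinP.toℕ-injective
      (injective (FinP.toℕ<n x) (FinP.toℕ<n y) (FinP.fromℕ<-injective _ _ _ _ Fx≡Fy))
    onto : ∀ y → ∃[ x ] F x ≡ y
    onto = injective⇒surjective F F-injective
    F⁻¹ : Fin N → Fin N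
    F⁻¹ y = proj₁ (onto y)

module Grid (b : ℕ) ⦃ _ : NonZero b ⦄ where

  col row : ℕ → ℕ
  col x = x % b
  row x = x / b

  col<b : ∀ x → col x < b
  col<b x = m%n<n x b

  col+row : ∀ x → x ≡ col x + row x * b
  col+row x = m≡m%n+[m/n]*n x b

  col-row-injective : ∀ {x y} → col x ≡ col y → row x ≡ row y → x ≡ y
  col-row-injective {x} {y} same-col same-row =
    trans (col+row x) (trans (cong₂ (λ t p → t + p * b) same-col same-row) (sym (col+row y)))

  col-cell : ∀ {t} p → t < b → col (t + p * b) ≡ t
  col-cell {t} p t<b = trans ([m+kn]%n≡m%n t p b) (m<n⇒m%n≡m t<b)

  row-cell : ∀ {t} p → t < b → row (t + p * b) ≡ p
  row-cell {t} p t<b = begin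
    (t + p * b) / b    ≡⟨ +-distrib-/-∣ʳ t (n∣m*n p) ⟩
    t / b + p * b / b  ≡⟨ cong₂ _+_ (m<n⇒m/n≡0 t<b) (m*n/n≡m p b) ⟩
    p                  ∎
    where open ≡-Reasoning

  cell<rows : ∀ {t p m} → t < b → p < m → t + p * b < m * b
  cell<rows {t} {p} {m} t<b p<m = begin-strict
    t + p * b  <⟨ +-monoˡ-< (p * b) t<b ⟩
    suc p * b  ≤⟨ *-monoˡ-≤ b p<m ⟩
    m * b      ∎
    where open ≤-Reasoning

  rows-below : ∀ {m x} → m * b ≤ x → m ≤ row x
  rows-below {m} {x} m*b≤x = subst (_≤ row x) (m*n/n≡m m b) (/-monoˡ-≤ b m*b≤x)

  next-row : ∀ {x y} → row x < row y → col x ≤ col y → x + b ≤ y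
  next-row {x} {y} rx<ry cx≤cy = begin
    x + b                    ≡⟨ cong (_+ b) (col+row x) ⟩
    col x + row x * b + b    ≡⟨ shift (col x) (row x) b ⟩
    col x + suc (row x) * b  ≤⟨ +-mono-≤ cx≤cy (*-monoˡ-≤ b rx<ry) ⟩
    col y + row y * b        ≡⟨ sym (col+row y) ⟩
    y                        ∎
    where
      open ≤-Reasoning
      shift : ∀ t p b → t + p * b + b ≡ t + suc p * b
      shift = solve-∀

  module Level (N : ℕ) where

    M r : ℕ
    M = N / b
    r = N % b

    N≡r+M*b : N ≡ r + M * b
    N≡r+M*b = col+row N

    r<b : r < b
    r<b = col<b N

    row≤M : ∀ {x} → x < N → row x ≤ M
    row≤M x<N = /-monoˡ-≤ b (<⇒≤ x<N)

    row<M : ∀ {x} → x < N → r ≤ col x → row x < M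
    row<M {x} x<N r≤col = ≰⇒> λ M≤row → <⇒≱ x<N (begin
      N                  ≡⟨ N≡r+M*b ⟩
      r + M * b          ≤⟨ +-mono-≤ r≤col (*-monoˡ-≤ b M≤row) ⟩
      col x + row x * b  ≡⟨ sym (col+row x) ⟩
      x                  ∎)
      where open ≤-Reasoning

    -- Column t holds M + 1 cells when t < r and M cells otherwise, so the
    -- columns before t hold `colStart t` cells.
    colStart : ℕ → ℕ
    colStart t = t * M + t ⊓ r

    colStart-mono₀ : ∀ {t t′} → t ≤ t′ → colStart t ≤ colStart t′
    colStart-mono₀ t≤t′ = +-mono-≤ (*-monoˡ-≤ M t≤t′) (⊓-monoˡ-≤ r t≤t′)

    -- Each of j further columns contributes at least M cells.
    colStart-mono : ∀ t {j} t′ → t + j ≤ t′ → colStart t + j * M ≤ colStart t′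
    colStart-mono t {j} t′ t+j≤t′ = begin
      t * M + t ⊓ r + j * M  ≡⟨ regroup t M (t ⊓ r) j ⟩
      (t + j) * M + t ⊓ r    ≤⟨ +-monoˡ-≤ (t ⊓ r) (*-monoˡ-≤ M t+j≤t′) ⟩
      t′ * M + t ⊓ r         ≤⟨ +-monoʳ-≤ (t′ * M) (⊓-monoˡ-≤ r (m+n≤o⇒m≤o t t+j≤t′)) ⟩
      t′ * M + t′ ⊓ r        ∎
      where
        open ≤-Reasoning
        regroup : ∀ t M u j → t * M + u + j * M ≡ (t + j) * M + u
        regroup = solve-∀

    colStart-b : colStart b ≡ N
    colStart-b rewrite m≥n⇒m⊓n≡n (<⇒≤ r<b) =
      trans (cong (_+ r) (*-comm b M)) (trans (+-comm (M * b) r) (sym N≡r+M*b))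

    fits-column : ∀ {x} → x < N → colStart (col x) + suc (row x) ≤ colStart (suc (col x))
    fits-column {x} x<N with col x <? r
    ... | yes t<r
      rewrite m≤n⇒m⊓n≡m (<⇒≤ t<r) | m≤n⇒m⊓n≡m t<r = begin
        col x * M + col x + suc (row x)  ≤⟨ +-monoʳ-≤ (col x * M + col x) (s≤s (row≤M x<N)) ⟩
        col x * M + col x + suc M        ≡⟨ longer (col x) M ⟩
        M + col x * M + suc (col x)      ∎
      where
        open ≤-Reasoning
        longer : ∀ t M → t * M + t + suc M ≡ M + t * M + suc t
        longer = solve-∀
    ... | no t≮r
      rewrite m≥n⇒m⊓n≡n (≮⇒≥ t≮r) | m≥n⇒m⊓n≡n (≤-trans (≮⇒≥ t≮r) (n≤1+n (col x))) = begin
        col x * M + r + suc (row x)  ≤⟨ +-monoʳ-≤ (col x * M + r) (row<M x<N (≮⇒≥ t≮r)) ⟩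
        col x * M + r + M            ≡⟨ shorter (col x) M r ⟩
        M + col x * M + r            ∎
      where
        open ≤-Reasoning
        shorter : ∀ t M r → t * M + r + M ≡ M + t * M + r
        shorter = solve-∀

    transpose : ℕ → ℕ
    transpose x = colStart (suc (col x)) ∸ suc (row x)

    transpose+row : ∀ {x} → x < N → transpose x + suc (row x) ≡ colStart (suc (col x))
    transpose+row {x} x<N = m∸n+n≡m (m+n≤o⇒n≤o (colStart (col x)) (fits-column x<N))

    colStart≤transpose : ∀ {x} → x < N → colStart (col x) ≤ transpose x
    colStart≤transpose {x} x<N = +-cancelʳ-≤ (suc (row x)) _ _
      (subst (colStart (col x) + suc (row x) ≤_) (sym (transpose+row x<N)) (fits-column x<N))

    transpose-shift : ∀ {x y j} → x < N → y < N → col x + j ≤ col y →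
                      transpose x + suc (row x) + j * M ≤ transpose y + suc (row y)
    transpose-shift {x} {y} x<N y<N shifted rewrite transpose+row x<N | transpose+row y<N =
      colStart-mono (suc (col x)) (suc (col y)) (s≤s shifted)

    transpose-room : ∀ {x} → x < N → transpose x + suc (row x) + (b ∸ suc (col x)) * M ≤ N
    transpose-room {x} x<N rewrite transpose+row x<N =
      subst (colStart (suc (col x)) + (b ∸ suc (col x)) * M ≤_) colStart-b
        (colStart-mono (suc (col x)) b (≤-reflexive (m+[n∸m]≡n (col<b x))))

    transpose-room₁ : ∀ {x} → x < N → transpose x + suc (row x) ≤ N
    transpose-room₁ x<N = m+n≤o⇒m≤o _ (transpose-room x<N)

    transpose-roomᴹ : ∀ {x} → x < N → suc (col x) < b → transpose x + suc M ≤ N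
    transpose-roomᴹ {x} x<N not-last = begin
      transpose x + suc M                             ≤⟨ +-monoʳ-≤ (transpose x) (s≤s M≤rest) ⟩
      transpose x + (suc (row x) + (b ∸ suc (col x)) * M)  ≡⟨ sym (+-assoc (transpose x) _ _) ⟩
      transpose x + suc (row x) + (b ∸ suc (col x)) * M    ≤⟨ transpose-room x<N ⟩
      N                                               ∎
      where
        open ≤-Reasoning
        instance
          later-columns : NonZero (b ∸ suc (col x))
          later-columns = >-nonZero (m<n⇒0<n∸m not-last)
        M≤rest : M ≤ row x + (b ∸ suc (col x)) * M
        M≤rest = ≤-trans (m≤n*m M (b ∸ suc (col x))) (m≤n+m _ (row x))

    transpose<N : ∀ {x} → x < N → transpose x < N
    transpose<N {x} x<N = ≤-trans (s≤s (m≤m+n (transpose x) (row x)))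
      (subst (_≤ N) (+-suc (transpose x) (row x)) (transpose-room₁ x<N))

    transpose-increasing : ∀ {x y} → x < N → y < N → col x < col y → transpose x < transpose y
    transpose-increasing {x} {y} x<N y<N cx<cy = begin-strict
      transpose x                ≤⟨ m≤m+n (transpose x) (row x) ⟩
      transpose x + row x        <⟨ +-monoʳ-< (transpose x) (n<1+n (row x)) ⟩
      transpose x + suc (row x)  ≡⟨ transpose+row x<N ⟩
      colStart (suc (col x))     ≤⟨ colStart-mono₀ cx<cy ⟩
      colStart (col y)           ≤⟨ colStart≤transpose y<N ⟩
      transpose y                ∎
      where open ≤-Reasoning

    transpose-injective : ∀ {x y} → x < N → y < N → transpose x ≡ transpose y → x ≡ y
    transpose-injective {x} {y} x<N y<N same with <-cmp (col x) (col y)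
    ... | tri< cx<cy _ _ = ⊥-elim (<⇒≢ (transpose-increasing x<N y<N cx<cy) same)
    ... | tri> _ _ cy<cx = ⊥-elim (<⇒≢ (transpose-increasing y<N x<N cy<cx) (sym same))
    ... | tri≈ _ same-col _ = col-row-injective same-col (suc-injective (+-cancelˡ-≡ (transpose x) _ _ (begin
          transpose x + suc (row x)  ≡⟨ transpose+row x<N ⟩
          colStart (suc (col x))        ≡⟨ cong (colStart ∘ suc) same-col ⟩
          colStart (suc (col y))        ≡⟨ sym (transpose+row y<N) ⟩
          transpose y + suc (row y)  ≡⟨ cong (_+ suc (row y)) (sym same) ⟩
          transpose x + suc (row y)  ∎)))
      where open ≡-Reasoning

    transpose-perm : PermOn N transpose
    transpose-perm = record { bound = transpose<N ; injective = transpose-injective }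

    transpose-apart : ∀ {x y} → x < N → y < N → col y < col x → row x ≤ row y →
                      transpose y + M ≤ transpose x
    transpose-apart {x} {y} x<N y<N cy<cx rx≤ry = +-cancelʳ-≤ (suc (row y)) _ _ (begin
      transpose y + M + suc (row y)          ≡⟨ one-column (transpose y) M (suc (row y)) ⟩
      transpose y + suc (row y) + 1 * M      ≤⟨ transpose-shift y<N x<N (subst (_≤ col x) (+-comm 1 (col y)) cy<cx) ⟩
      transpose x + suc (row x)              ≤⟨ +-monoʳ-≤ (transpose x) (s≤s rx≤ry) ⟩
      transpose x + suc (row y)              ∎)
      where
        open ≤-Reasoning
        one-column : ∀ u M v → u + M + v ≡ u + v + 1 * M
        one-column = solve-∀

    transpose-far : ∀ {x y} → x < N → y < N → col y + 2 ≤ col x → transpose y + M ≤ transpose x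
    transpose-far {x} {y} x<N y<N far = +-cancelʳ-≤ (M + suc (row y)) _ _ (begin
      transpose y + M + (M + suc (row y))    ≡⟨ two-columns (transpose y) M (suc (row y)) ⟩
      transpose y + suc (row y) + 2 * M      ≤⟨ transpose-shift y<N x<N far ⟩
      transpose x + suc (row x)              ≤⟨ +-monoʳ-≤ (transpose x) (s≤s (≤-trans (row≤M x<N) (m≤m+n M _))) ⟩
      transpose x + suc (M + row y)          ≡⟨ cong (_+_ (transpose x)) (sym (+-suc M (row y))) ⟩
      transpose x + (M + suc (row y))        ∎)
      where
        open ≤-Reasoning
        two-columns : ∀ u M v → u + M + (M + v) ≡ u + v + 2 * M
        two-columns = solve-∀

    M*b≤N : M * b ≤ N
    M*b≤N = subst (M * b ≤_) (sym N≡r+M*b) (m≤n+m (M * b) r)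

    lift : (ℕ → ℕ) → ℕ → ℕ
    lift g x with row x <? M
    ... | yes _ = col x + g (row x) * b
    ... | no _  = x

    lift-inside : ∀ g {x} → row x < M → lift g x ≡ col x + g (row x) * b
    lift-inside g {x} in-full with row x <? M
    ... | yes _ = refl
    ... | no out = ⊥-elim (out in-full)

    partial-row : ∀ {x} → x < N → ¬ row x < M → row x ≡ M
    partial-row x<N out = ≤-antisym (row≤M x<N) (≮⇒≥ out)

    lift-outside : ∀ g {x} → x < N → ¬ row x < M → lift g x ≡ col x + M * b
    lift-outside g {x} x<N out with row x <? M
    ... | yes in-full = ⊥-elim (out in-full)
    ... | no _ = trans (col+row x) (cong (λ p → col x + p * b) (partial-row x<N out))

    lift-perm : ∀ {g} → PermOn M g → PermOn N (lift g)
    lift-perm {g} g-perm = record { bound = bound ; injective = injective }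
      where
        module G = PermOn g-perm

        lifted<M*b : ∀ {x} → row x < M → col x + g (row x) * b < M * b
        lifted<M*b {x} in-full = cell<rows (col<b x) (G.bound in-full)

        bound : ∀ {x} → x < N → lift g x < N
        bound {x} x<N with row x <? M
        ... | yes in-full = ≤-trans (lifted<M*b in-full) M*b≤N
        ... | no _ = x<N

        same-col : ∀ {x y} → lift g x ≡ lift g y → col x ≡ col y
        same-col {x} {y} same = trans (sym (col-lift x)) (trans (cong col same) (col-lift y))
          where
            col-lift : ∀ z → col (lift g z) ≡ col z
            col-lift z with row z <? M
            ... | yes z-in = col-cell (g (row z)) (col<b z)
            ... | no _ = refl

        injective : ∀ {x y} → x < N → y < N → lift g x ≡ lift g y → x ≡ y
        injective {x} {y} x<N y<N same = col-row-injective (same-col same) (same-row (row x <? M) (row y <? M))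
          where
            row-image : ∀ {z p} → lift g z ≡ col z + p * b → row (lift g z) ≡ p
            row-image {z} {p} eq = trans (cong row eq) (row-cell p (col<b z))
            same-row : Dec (row x < M) → Dec (row y < M) → row x ≡ row y
            same-row (yes x-in) (yes y-in) = G.injective x-in y-in
              (trans (sym (row-image (lift-inside g x-in))) (trans (cong row same) (row-image (lift-inside g y-in))))
            same-row (yes x-in) (no y-out) = ⊥-elim (<-irrefl
              (trans (sym (row-image (lift-inside g x-in))) (trans (cong row same) (row-image (lift-outside g y<N y-out))))
              (G.bound x-in))
            same-row (no x-out) (yes y-in) = ⊥-elim (<-irrefl
              (trans (sym (row-image (lift-inside g y-in))) (trans (cong row (sym same)) (row-image (lift-outside g x<N x-out))))
              (G.bound y-in))
            same-row (no x-out) (no y-out) = trans (partial-row x<N x-out) (sym (partial-row y<N y-out))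

  family : (k : ℕ) → ℕ → Fin (suc k) → ℕ → ℕ
  family zero    N _       = id
  family (suc k) N zero    = Level.transpose N
  family (suc k) N (suc i) = Level.lift N (family k (N / b) i)

  family-perm : ∀ k N i → PermOn N (family k N i)
  family-perm zero    N _       = record { bound = id ; injective = λ _ _ same → same }
  family-perm (suc k) N zero    = Level.transpose-perm N
  family-perm (suc k) N (suc i) = Level.lift-perm N (family-perm k (N / b) i)

  Separates : ℕ → ℕ → ℕ → Set
  Separates k N s = ∀ {x y} → x < N → y < N → x ≢ y → ∃[ i ] Apart s (family k N i x) (family k N i y)

  -- Every point lies at least s below N in some map of the family; this is
  -- what separates the full rows from the partial row one level up.
  Headroom : ℕ → ℕ → ℕ → Set
  Headroom k N s = ∀ {x} → x < N → ∃[ i ] family k N i x + s ≤ N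

  StrongHeadroom : ℕ → ℕ → ℕ → ℕ → Set
  StrongHeadroom k N s t = ∀ {z} → z < N → suc z < t → ∃[ i ] family k N i z + suc s ≤ N

  swapped : ∀ {k N s x y} → ∃[ i ] Apart s (family k N i y) (family k N i x) →
            ∃[ i ] Apart s (family k N i x) (family k N i y)
  swapped = map₂ swap

  by-transpose : ∀ {k N s x y} → s ≤ N / b → Level.transpose N y + N / b ≤ Level.transpose N x →
                 ∃[ i ] Apart s (family (suc k) N i x) (family (suc k) N i y)
  by-transpose {y = y} s≤M far = zero , inj₂ (≤-trans (+-monoʳ-≤ (Level.transpose _ y) s≤M) far)

  same-row-apart : ∀ {k N s x y} → s ≤ N / b → x < N → y < N → row x ≡ row y → x ≢ y →
                   ∃[ i ] Apart s (family (suc k) N i x) (family (suc k) N i y)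
  same-row-apart {N = N} {x = x} {y} s≤M x<N y<N same-row x≢y with <-cmp (col x) (col y)
  ... | tri< cx<cy _ _ = swapped (by-transpose s≤M (Level.transpose-apart N y<N x<N cx<cy (≤-reflexive (sym same-row))))
  ... | tri≈ _ same-col _ = ⊥-elim (x≢y (col-row-injective same-col same-row))
  ... | tri> _ _ cy<cx = by-transpose s≤M (Level.transpose-apart N x<N y<N cy<cx (≤-reflexive same-row))

  cells-apart : ∀ {s s′ L p q tx ty} → s′ + L ≤ b * s → p + s ≤ q → tx ≤ ty + L →
                tx + p * b + s′ ≤ ty + q * b
  cells-apart {s} {s′} {L} {p} {q} {tx} {ty} s′+L≤bs p+s≤q tx≤ty+L = begin
    tx + p * b + s′         ≤⟨ +-monoˡ-≤ s′ (+-monoˡ-≤ (p * b) tx≤ty+L) ⟩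
    ty + L + p * b + s′     ≡⟨ regroup ty L (p * b) s′ ⟩
    ty + p * b + (s′ + L)   ≤⟨ +-monoʳ-≤ (ty + p * b) s′+L≤bs ⟩
    ty + p * b + b * s      ≡⟨ collect ty p b s ⟩
    ty + (p + s) * b        ≤⟨ +-monoʳ-≤ ty (*-monoˡ-≤ b p+s≤q) ⟩
    ty + q * b              ∎
    where
      open ≤-Reasoning
      regroup : ∀ ty L u s′ → ty + L + u + s′ ≡ ty + u + (s′ + L)
      regroup = solve-∀
      collect : ∀ ty p b s → ty + p * b + b * s ≡ ty + (p + s) * b
      collect = solve-∀

  cell-below-row : ∀ {s s′ p q t} → s′ ≤ b * s → p + suc s ≤ q → t < b → t + p * b + s′ ≤ q * b
  cell-below-row {s} {s′} {p} {q} {t} s′≤bs p+s<q t<b = <⇒≤ (begin-strict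
    t + p * b + s′     ≤⟨ +-monoʳ-≤ (t + p * b) s′≤bs ⟩
    t + p * b + b * s  <⟨ +-monoˡ-< (b * s) (+-monoˡ-< (p * b) t<b) ⟩
    b + p * b + b * s  ≡⟨ collect b p s ⟩
    (p + suc s) * b    ≤⟨ *-monoˡ-≤ b p+s<q ⟩
    q * b              ∎)
    where
      open ≤-Reasoning
      collect : ∀ b p s → b + p * b + b * s ≡ (p + suc s) * b
      collect = solve-∀

  -- The
  -- strong headroom is only needed when the columns can be far apart (L + 1 < b).
  module Step (k N s s′ L : ℕ) (L≥1 : 1 ≤ L) (s′+L≤bs : s′ + L ≤ b * s) (s′≤M : s′ ≤ N / b)
              (sep : Separates k (N / b) s) (room : Headroom k (N / b) s)
              (room⁺ : suc L < b → StrongHeadroom k (N / b) s s′) where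
    open Level N

    F : Fin (suc (suc k)) → ℕ → ℕ
    F = family (suc k) N

    by-rows : ∀ {x y i q} → x < N → y < N → row x < M → lift (family k M i) y ≡ col y + q * b →
              family k M i (row x) + s ≤ q → ∃[ j ] Apart s′ (F j x) (F j y)
    by-rows {x} {y} {i} x<N y<N x-in lift-y rows-apart with col x ≤? col y + L
    ... | yes close = suc i , inj₁ (subst₂ (λ u v → u + s′ ≤ v)
                        (sym (lift-inside _ x-in)) (sym lift-y) (cells-apart s′+L≤bs rows-apart close))
    ... | no far = by-transpose s′≤M (transpose-far x<N y<N (two-columns (≰⇒> far)))
      where
        two-columns : col y + L < col x → col y + 2 ≤ col x
        two-columns far = ≤-trans (+-monoʳ-≤ (col y) (s≤s L≥1)) (subst (_≤ col x) (sym (+-suc (col y) L)) far)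

    separates : Separates (suc k) N s′
    separates {x} {y} x<N y<N x≢y with row x ≟ row y
    ... | yes same-row = same-row-apart s′≤M x<N y<N same-row x≢y
    ... | no diff-row with row x <? M | row y <? M
    ...   | yes x-in | yes y-in = by-row-images (sep x-in y-in diff-row)
      where
        by-row-images : ∃[ i ] Apart s (family k M i (row x)) (family k M i (row y)) → ∃[ j ] Apart s′ (F j x) (F j y)
        by-row-images (i , inj₁ below) = by-rows x<N y<N x-in (lift-inside _ y-in) below
        by-row-images (i , inj₂ above) = swapped (by-rows y<N x<N y-in (lift-inside _ x-in) above)
    ...   | yes x-in | no y-out = let (i , below) = room x-in in by-rows x<N y<N x-in (lift-outside _ y<N y-out) below
    ...   | no x-out | yes y-in = let (i , below) = room y-in in swapped (by-rows y<N x<N y-in (lift-outside _ x<N x-out) below)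
    ...   | no x-out | no y-out = ⊥-elim (diff-row (trans (partial-row x<N x-out) (sym (partial-row y<N y-out))))

    high⇒full-row : ∀ {x} → ¬ s′ ≤ suc (row x) → row x < M
    high⇒full-row high = ≤-trans (n≤1+n _) (≤-trans (≰⇒> high) s′≤M)

    far⇒L+1<b : ∀ {x} → ¬ col x ≤ r + L → suc L < b
    far⇒L+1<b {x} far = ≤-<-trans (m+n≤o⇒n≤o r (subst (_≤ col x) (sym (+-suc r L)) (≰⇒> far))) (col<b x)

    headroom : Headroom (suc k) N s′
    headroom {x} x<N with s′ ≤? suc (row x)
    ... | yes low-enough = zero , ≤-trans (+-monoʳ-≤ (transpose x) low-enough) (transpose-room₁ x<N)
    ... | no high with room (high⇒full-row high)
    ...   | i , below with col x ≤? r + L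
    ...     | yes close = suc i , subst₂ (λ u v → u + s′ ≤ v)
                (sym (lift-inside _ (high⇒full-row high))) (sym N≡r+M*b) (cells-apart s′+L≤bs below close)
    ...     | no far with room⁺ (far⇒L+1<b far) (high⇒full-row high) (≰⇒> high)
    ...       | i′ , below⁺ = suc i′ , subst (λ u → u + s′ ≤ N) (sym (lift-inside _ (high⇒full-row high)))
                (≤-trans (cell-below-row (m+n≤o⇒m≤o s′ s′+L≤bs) below⁺ (col<b x)) M*b≤N)

module Construction (a : ℕ) where

  b : ℕ
  b = suc (suc a)

  open Grid b

  -- b² − 2, written as a polynomial in a.
  b²-2 : ℕ
  b²-2 = a + suc a * b

  late-row : ∀ {x} → b * b < x + suc b → suc a ≤ row x
  late-row {x} late = rows-below (≤-pred (+-cancelˡ-< b _ _ (subst (b * b <_) (reorder x b) late)))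
    where
      reorder : ∀ x b → x + suc b ≡ b + suc x
      reorder = solve-∀

  power-rows : ∀ m {N} → b ^ suc m ≤ N → b ^ m ≤ N / b
  power-rows m {N} bᵐ⁺¹≤N = rows-below (subst (_≤ N) (*-comm b (b ^ m)) bᵐ⁺¹≤N)

  module FirstLevel (N : ℕ) (b²≤N : b ^ 2 ≤ N) where
    open Level N

    b*b≤N : b * b ≤ N
    b*b≤N = subst (_≤ N) (cong (b *_) (*-identityʳ b)) b²≤N

    b≤M : b ≤ M
    b≤M = rows-below b*b≤N

    F : Fin 2 → ℕ → ℕ
    F = family 1 N

    lift-id : ∀ x → F (suc zero) x ≡ x
    lift-id x with row x <? M
    ... | yes _ = sym (col+row x)
    ... | no _  = refl

    by-identity : ∀ {x y} → x + b ≤ y → ∃[ i ] Apart b (F i x) (F i y)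
    by-identity {x} {y} x+b≤y = suc zero , inj₁ (subst₂ (λ u v → u + b ≤ v) (sym (lift-id x)) (sym (lift-id y)) x+b≤y)

    -- x in an earlier row than y: the identity separates them unless x lies
    -- to the right of y, and then the transposition does.
    earlier-row : ∀ {x y} → x < N → y < N → row x < row y → ∃[ i ] Apart b (F i x) (F i y)
    earlier-row {x} {y} x<N y<N rx<ry with col x ≤? col y
    ... | yes cx≤cy = by-identity (next-row rx<ry cx≤cy)
    ... | no cx≰cy = by-transpose b≤M (transpose-apart x<N y<N (≰⇒> cx≰cy) (<⇒≤ rx<ry))

    separates : Separates 1 N b
    separates {x} {y} x<N y<N x≢y with <-cmp (row x) (row y)
    ... | tri< rx<ry _ _    = earlier-row x<N y<N rx<ry
    ... | tri≈ _ same-row _ = same-row-apart b≤M x<N y<N same-row x≢y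
    ... | tri> _ _ ry<rx    = swapped (earlier-row y<N x<N ry<rx)

    -- The identity gives headroom b, except near the top, where the
    -- transposition does since those points lie in row b - 1 or higher.
    headroom : Headroom 1 N b
    headroom {x} x<N with x + b ≤? N
    ... | yes fits = suc zero , subst (λ u → u + b ≤ N) (sym (lift-id x)) fits
    ... | no top   = zero , ≤-trans (+-monoʳ-≤ (transpose x) late) (transpose-room₁ x<N)
      where
        late : b ≤ suc (row x)
        late = s≤s (late-row (≤-<-trans b*b≤N (≤-trans (≰⇒> top) (+-monoʳ-≤ x (n≤1+n b)))))

    -- Headroom b + 1 for the points z < b² − 2: if z is near the top, it lies
    -- in row b − 1 or higher but not in the last column (else z ≥ b² − 1), so
    -- the transposition leaves at least one later column free.
    strong-headroom : StrongHeadroom 1 N b (b²-2 + 1)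
    strong-headroom {z} z<N small with z + suc b ≤? N
    ... | yes fits = suc zero , subst (λ u → u + suc b ≤ N) (sym (lift-id z)) fits
    ... | no top with suc (col z) <? b
    ...   | yes not-last = zero , ≤-trans (+-monoʳ-≤ (transpose z) (s≤s b≤M)) (transpose-roomᴹ z<N not-last)
    ...   | no last = ⊥-elim (<-asym z-small z-large)
      where
        z-small : z < b²-2
        z-small = ≤-pred (subst (suc z <_) (+-comm b²-2 1) small)
        z-large : b²-2 < z
        z-large = subst (b²-2 <_) (sym (col+row z))
          (+-mono-≤ (≤-pred (≮⇒≥ last)) (*-monoˡ-≤ b (late-row (≤-<-trans b*b≤N (≰⇒> top)))))

  -- The separation reached with k′ + 1 maps: the least integer above
  -- b^k′ − 2 b^(k′-2), i.e. 1, b, and (b² − 2) b^j + 1 for k′ = j + 2.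
  required : ℕ → ℕ
  required 0             = 1
  required 1             = b
  required (suc (suc j)) = b²-2 * b ^ j + 1

  required₂+1 : required 2 + 1 ≡ b * b
  required₂+1 = identity a
    where
      identity : ∀ a → (a + suc a * suc (suc a)) * 1 + 1 + 1 ≡ suc (suc a) * suc (suc a)
      identity = solve-∀

  required-step : ∀ j → required (3 + j) + suc a ≡ b * required (2 + j)
  required-step j = identity a (b ^ j)
    where
      identity : ∀ a p → (a + suc a * suc (suc a)) * (suc (suc a) * p) + 1 + suc a
                         ≡ suc (suc a) * ((a + suc a * suc (suc a)) * p + 1)
      identity = solve-∀

  required≤power : ∀ j → required (2 + j) ≤ b ^ (2 + j)
  required≤power j = begin
    b²-2 * b ^ j + 1          ≤⟨ +-monoʳ-≤ (b²-2 * b ^ j) (≤-trans (m^n>0 b j) (m≤m+n (b ^ j) _)) ⟩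
    b²-2 * b ^ j + 2 * b ^ j  ≡⟨ identity a (b ^ j) ⟩
    b ^ (2 + j)               ∎
    where
      open ≤-Reasoning
      identity : ∀ a p → (a + suc a * suc (suc a)) * p + 2 * p ≡ suc (suc a) * (suc (suc a) * p)
      identity = solve-∀

  -- Separation and headroom with j + 3 maps, by induction on j: the first
  -- step starts from the two-map level (columns at most L = 1 apart, using the
  -- strong headroom), later steps allow any columns (L = b − 1).
  deep : ∀ j N → b ^ (3 + j) ≤ N →
         Separates (2 + j) N (required (2 + j)) × Headroom (2 + j) N (required (2 + j))
  deep zero N b³≤N = S.separates , S.headroom
    where
      b²≤M : b ^ 2 ≤ N / b
      b²≤M = power-rows 2 b³≤N
      module First = FirstLevel (N / b) b²≤M
      module S = Step 1 N b (required 2) 1 ≤-refl (≤-reflexive required₂+1)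
                   (≤-trans (required≤power 0) b²≤M) First.separates First.headroom
                   (λ _ → subst (StrongHeadroom 1 (N / b) b) (cong (_+ 1) (sym (*-identityʳ b²-2))) First.strong-headroom)
  deep (suc j) N bʲ⁺⁴≤N = S.separates , S.headroom
    where
      bʲ⁺³≤M : b ^ (3 + j) ≤ N / b
      bʲ⁺³≤M = power-rows (3 + j) bʲ⁺⁴≤N
      IH : Separates (2 + j) (N / b) (required (2 + j)) × Headroom (2 + j) (N / b) (required (2 + j))
      IH = deep j (N / b) bʲ⁺³≤M
      module S = Step (2 + j) N (required (2 + j)) (required (3 + j)) (suc a) (s≤s z≤n)
                   (≤-reflexive (required-step j)) (≤-trans (required≤power (suc j)) bʲ⁺³≤M)
                   (proj₁ IH) (proj₂ IH) (λ b<b → ⊥-elim (<-irrefl refl b<b))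

  separation : ∀ k′ N → b ^ suc k′ ≤ N → Separates k′ N (required k′)
  separation zero N _ _ _ x≢y = zero , distinct⇒apart x≢y
  separation 1 N b²≤N = FirstLevel.separates N b²≤N
  separation (suc (suc j)) N bʲ⁺³≤N = proj₁ (deep j N bʲ⁺³≤N)

  power-exceeds : ∀ k′ d → b ^ k′ ≤ d → b ^ (2 + k′) < 2 * b ^ k′ + b ^ 2 * d
  power-exceeds k′ d bᵏ′≤d = begin-strict
    b ^ (2 + k′)     ≡⟨ ^-distribˡ-+-* b 2 k′ ⟩
    b ^ 2 * b ^ k′   ≤⟨ *-monoʳ-≤ (b ^ 2) bᵏ′≤d ⟩
    b ^ 2 * d        <⟨ m<n+m (b ^ 2 * d) (≤-trans (m^n>0 b k′) (m≤m+n (b ^ k′) _)) ⟩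
    2 * b ^ k′ + b ^ 2 * d  ∎
    where open ≤-Reasoning

  required-exceeds : ∀ k′ d → required k′ ≤ d → b ^ (2 + k′) < 2 * b ^ k′ + b ^ 2 * d
  required-exceeds 0 d 1≤d = power-exceeds 0 d 1≤d
  required-exceeds 1 d b≤d = power-exceeds 1 d (subst (_≤ d) (sym (*-identityʳ b)) b≤d)
  required-exceeds (suc (suc j)) d required≤d = begin-strict
    b ^ (4 + j)                                       <⟨ m<m+n (b ^ (4 + j)) (m^n>0 b 2) ⟩
    b ^ (4 + j) + b ^ 2                               ≡⟨ identity a (b ^ j) ⟩
    2 * b ^ (2 + j) + b ^ 2 * required (2 + j)        ≤⟨ +-monoʳ-≤ (2 * b ^ (2 + j)) (*-monoʳ-≤ (b ^ 2) required≤d) ⟩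
    2 * b ^ (2 + j) + b ^ 2 * d                       ∎
    where
      open ≤-Reasoning
      identity : ∀ a p → let B = suc (suc a) in
        B * (B * (B * (B * p))) + B * (B * 1)
          ≡ 2 * (B * (B * p)) + B * (B * 1) * ((a + suc a * B) * p + 1)
      identity = solve-∀

  exceeds : ∀ k′ d → required k′ ≤ d → ExceedsThreshold b (suc k′) d
  exceeds k′ d required≤d = ℕ-gap⇒ℤ {B = 2 * b ^ k′} (required-exceeds k′ d required≤d)

  theorem : ∀ n k′ → b ^ suc k′ ≤ suc n →
    Σ (Fin (suc k′) → Permutation′ (suc n)) λ φ →
      (x y : Fin (suc n)) → ¬ x ≡ y →
        ∃[ i ] ExceedsThreshold b (suc k′) (dist (φ i ⟨$⟩ʳ x) (φ i ⟨$⟩ʳ y))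
  theorem n k′ bᵏ≤N = φ , separated
    where
      π : ∀ i → Σ (Permutation′ (suc n)) λ π → ∀ x → toℕ (π ⟨$⟩ʳ x) ≡ family k′ (suc n) i (toℕ x)
      π i = toPermutation (family-perm k′ (suc n) i)

      φ : Fin (suc k′) → Permutation′ (suc n)
      φ i = proj₁ (π i)

      separated : (x y : Fin (suc n)) → ¬ x ≡ y →
                  ∃[ i ] ExceedsThreshold b (suc k′) (dist (φ i ⟨$⟩ʳ x) (φ i ⟨$⟩ʳ y))
      separated x y x≢y =
        let (i , apart) = separation k′ (suc n) bᵏ≤N (FinP.toℕ<n x) (FinP.toℕ<n y) (x≢y ∘ FinP.toℕ-injective)
        in i , exceeds k′ _ (subst (required k′ ≤_)
                 (sym (cong₂ ∣_-_∣ (proj₂ (π i) x) (proj₂ (π i) y))) (apart⇒dist apart))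

lemma4p3 : (n b k : ℕ) → n > 0 → k > 0 → 2 ≤ b → b ^ k ≤ suc n →
    Σ (Fin k → Permutation′ (suc n)) λ φ →
      (x y : Fin (suc n)) → ¬ x ≡ y →
        ∃[ i ] ExceedsThreshold b k (dist (φ i ⟨$⟩ʳ x) (φ i ⟨$⟩ʳ y))
lemma4p3 n b zero _ () _ _
lemma4p3 n .(suc (suc a)) (suc k′) _ _ (s≤s (s≤s (z≤n {a}))) bᵏ≤N = Construction.theorem a n k′ bᵏ≤N
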